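{- Let $X$ be a set with a binary operation $\ast$ and an element $0\in X$ such that for all $x,y,z\in X$: (G) $((x\ast y)\ast z)\ast((x\ast(z\ast 0))\ast y)=0$, and (A3) if $x\ast y=0$ and $y\ast x=0$ then $x=y$. Then $((x\ast y)\ast z)\ast((x\ast z)\ast y) = 0$ for all $x,y,z\in X$. -}

{-# OPTIONS --safe #-}
-- Write x ≤ y for x ∗ y ≡ 𝟎, so that (G) reads (x ∗ y) ∗ z ≤ (x ∗ (z ∗ 𝟎)) ∗ y
-- and (A3) is antisymmetry; it suffices to show x ∗ 𝟎 ≡ x. Instantiating (G)
-- so that a subterm is itself an instance of (G), or of an inequality derived
-- before, makes that subterm collapse to 𝟎; a handful of such instances give
-- 𝟎 ∗ 𝟎 ≡ 𝟎. From then on (G) with x = y = 𝟎 shows that whatever lies below 𝟎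
-- is 𝟎, and (G) with z = 𝟎 ∗ 𝟎 shows x ∗ y ≤ (x ∗ 𝟎) ∗ y. Together with (G)
-- for y = 𝟎 these give x ≤ x ∗ 𝟎 and x ∗ 𝟎 ≤ x.
module Submission where

open import Level using (Level)
open import Relation.Binary.PropositionalEquality using (_≡_; refl; trans; cong₂; subst; subst₂)

module Properties
  {a : Level} {X : Set a} (_∗_ : X → X → X) (𝟎 : X)
  (G : ∀ x y z → ((x ∗ y) ∗ z) ∗ ((x ∗ (z ∗ 𝟎)) ∗ y) ≡ 𝟎)
  (A3 : ∀ x y → x ∗ y ≡ 𝟎 → y ∗ x ≡ 𝟎 → x ≡ y)
  where

  infix 4 _≤_
  _≤_ : X → X → Set a
  x ≤ y = x ∗ y ≡ 𝟎

  lhs≡𝟎⇒𝟎≤rhs : ∀ {x y z} → (x ∗ y) ∗ z ≡ 𝟎 → 𝟎 ≤ (x ∗ (z ∗ 𝟎)) ∗ y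
  lhs≡𝟎⇒𝟎≤rhs {x} {y} {z} p = subst (_≤ (x ∗ (z ∗ 𝟎)) ∗ y) p (G x y z)

  rhs≡𝟎⇒lhs≤𝟎 : ∀ {x y z} → (x ∗ (z ∗ 𝟎)) ∗ y ≡ 𝟎 → (x ∗ y) ∗ z ≤ 𝟎
  rhs≡𝟎⇒lhs≤𝟎 {x} {y} {z} p = subst ((x ∗ y) ∗ z ≤_) p (G x y z)

  x∗[z∗𝟎]≡𝟎⇒[x∗y]∗z≤𝟎∗y : ∀ {x y z} → x ∗ (z ∗ 𝟎) ≡ 𝟎 → (x ∗ y) ∗ z ≤ 𝟎 ∗ y
  x∗[z∗𝟎]≡𝟎⇒[x∗y]∗z≤𝟎∗y {x} {y} {z} p = subst (λ s → (x ∗ y) ∗ z ≤ s ∗ y) p (G x y z)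

  G²ˡ : ∀ x y z → 𝟎 ≤ ((x ∗ y) ∗ (((x ∗ (z ∗ 𝟎)) ∗ y) ∗ 𝟎)) ∗ z
  G²ˡ x y z = lhs≡𝟎⇒𝟎≤rhs (G x y z)

  G²ʳ : ∀ x y z → ((x ∗ y) ∗ ((x ∗ ((z ∗ 𝟎) ∗ 𝟎)) ∗ y)) ∗ z ≤ 𝟎
  G²ʳ x y z = rhs≡𝟎⇒lhs≤𝟎 (G x y (z ∗ 𝟎))

  𝟎∗[x∗𝟎]≤𝟎∗[[x∗𝟎]∗𝟎] : ∀ x → 𝟎 ∗ (x ∗ 𝟎) ≤ 𝟎 ∗ ((x ∗ 𝟎) ∗ 𝟎)
  𝟎∗[x∗𝟎]≤𝟎∗[[x∗𝟎]∗𝟎] x = 𝟎∗z≤𝟎∗[z∗𝟎] [x∗𝟎]∗t≤[x∗𝟎]∗𝟎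
    where
    𝟎∗z≤𝟎∗[z∗𝟎] : ∀ {y z} → y ≤ z ∗ 𝟎 → 𝟎 ∗ z ≤ 𝟎 ∗ (z ∗ 𝟎)
    𝟎∗z≤𝟎∗[z∗𝟎] {y} {z} p = subst (λ s → s ∗ z ≤ s ∗ (z ∗ 𝟎)) p (G y (z ∗ 𝟎) z)

    t : X
    t = ((𝟎 ∗ 𝟎) ∗ ((𝟎 ∗ ((𝟎 ∗ 𝟎) ∗ 𝟎)) ∗ 𝟎)) ∗ 𝟎

    [x∗𝟎]∗t≤[x∗𝟎]∗𝟎 : (x ∗ 𝟎) ∗ t ≤ (x ∗ 𝟎) ∗ 𝟎
    [x∗𝟎]∗t≤[x∗𝟎]∗𝟎 = subst (λ s → (x ∗ 𝟎) ∗ t ≤ (x ∗ s) ∗ 𝟎) (G²ʳ 𝟎 𝟎 𝟎) (G x 𝟎 t)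

  [𝟎∗[𝟎∗[[x∗𝟎]∗𝟎]]]∗x≤𝟎 : ∀ x → (𝟎 ∗ (𝟎 ∗ ((x ∗ 𝟎) ∗ 𝟎))) ∗ x ≤ 𝟎
  [𝟎∗[𝟎∗[[x∗𝟎]∗𝟎]]]∗x≤𝟎 x = rhs≡𝟎⇒lhs≤𝟎 (𝟎∗[x∗𝟎]≤𝟎∗[[x∗𝟎]∗𝟎] x)

  𝟎≤[[[x∗𝟎]∗y]∗𝟎]∗[x∗[[y∗𝟎]∗𝟎]] : ∀ x y → 𝟎 ≤ (((x ∗ 𝟎) ∗ y) ∗ 𝟎) ∗ (x ∗ ((y ∗ 𝟎) ∗ 𝟎))
  𝟎≤[[[x∗𝟎]∗y]∗𝟎]∗[x∗[[y∗𝟎]∗𝟎]] x y =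
    subst (λ s → 𝟎 ≤ (((x ∗ 𝟎) ∗ y) ∗ s) ∗ (x ∗ ((y ∗ 𝟎) ∗ 𝟎)))
          (G²ʳ x 𝟎 y)
          (G²ˡ (x ∗ 𝟎) y (x ∗ ((y ∗ 𝟎) ∗ 𝟎)))

  𝟎≤𝟎∗𝟎 : 𝟎 ≤ 𝟎 ∗ 𝟎
  𝟎≤𝟎∗𝟎 =
    subst₂ (λ s t → 𝟎 ≤ s ∗ t)
           [𝟎∗𝟎]∗[𝟎∗u]≤𝟎
           𝟎≤[[𝟎∗u]∗𝟎]∗𝟎
           (𝟎≤[[[x∗𝟎]∗y]∗𝟎]∗[x∗[[y∗𝟎]∗𝟎]] 𝟎 (𝟎 ∗ u))
    where
    -- chosen so that u ∗ 𝟎 ≤ 𝟎 is [𝟎∗[𝟎∗[[x∗𝟎]∗𝟎]]]∗x≤𝟎 at x = 𝟎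
    u : X
    u = 𝟎 ∗ (𝟎 ∗ ((𝟎 ∗ 𝟎) ∗ 𝟎))

    [𝟎∗[𝟎∗𝟎]]∗u≤𝟎 : (𝟎 ∗ (𝟎 ∗ 𝟎)) ∗ u ≤ 𝟎
    [𝟎∗[𝟎∗𝟎]]∗u≤𝟎 =
      subst (λ s → (𝟎 ∗ (𝟎 ∗ s)) ∗ u ≤ 𝟎)
            ([𝟎∗[𝟎∗[[x∗𝟎]∗𝟎]]]∗x≤𝟎 𝟎)
            ([𝟎∗[𝟎∗[[x∗𝟎]∗𝟎]]]∗x≤𝟎 u)

    𝟎≤[[𝟎∗u]∗𝟎]∗𝟎 : 𝟎 ≤ ((𝟎 ∗ u) ∗ 𝟎) ∗ 𝟎
    𝟎≤[[𝟎∗u]∗𝟎]∗𝟎 = subst (λ s → 𝟎 ≤ ((𝟎 ∗ u) ∗ s) ∗ 𝟎) [𝟎∗[𝟎∗𝟎]]∗u≤𝟎 (G²ˡ 𝟎 u 𝟎)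

    [𝟎∗𝟎]∗[𝟎∗u]≤𝟎 : (𝟎 ∗ 𝟎) ∗ (𝟎 ∗ u) ≤ 𝟎
    [𝟎∗𝟎]∗[𝟎∗u]≤𝟎 =
      subst (λ s → (𝟎 ∗ s) ∗ (𝟎 ∗ u) ≤ 𝟎)
            𝟎≤[[𝟎∗u]∗𝟎]∗𝟎
            ([𝟎∗[𝟎∗[[x∗𝟎]∗𝟎]]]∗x≤𝟎 (𝟎 ∗ u))

  [[[x∗𝟎]∗y]∗z]∗[x∗[y∗𝟎]]≤𝟎∗z : ∀ x y z → (((x ∗ 𝟎) ∗ y) ∗ z) ∗ (x ∗ (y ∗ 𝟎)) ≤ 𝟎 ∗ z
  [[[x∗𝟎]∗y]∗z]∗[x∗[y∗𝟎]]≤𝟎∗z x y z = x∗[z∗𝟎]≡𝟎⇒[x∗y]∗z≤𝟎∗y (G x 𝟎 y)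

  𝟎∗𝟎≤𝟎∗[𝟎∗𝟎] : 𝟎 ∗ 𝟎 ≤ 𝟎 ∗ (𝟎 ∗ 𝟎)
  𝟎∗𝟎≤𝟎∗[𝟎∗𝟎] =
    subst₂ (λ s t → s ∗ t ≤ 𝟎 ∗ (𝟎 ∗ 𝟎))
           ([[[x∗𝟎]∗y]∗z]∗[x∗[y∗𝟎]]≤𝟎∗z 𝟎 𝟎 𝟎)
           (G 𝟎 𝟎 𝟎)
           ([[[x∗𝟎]∗y]∗z]∗[x∗[y∗𝟎]]≤𝟎∗z ((𝟎 ∗ 𝟎) ∗ 𝟎) (𝟎 ∗ (𝟎 ∗ 𝟎)) (𝟎 ∗ 𝟎))

  𝟎∗𝟎≡𝟎 : 𝟎 ∗ 𝟎 ≡ 𝟎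
  𝟎∗𝟎≡𝟎 = A3 (𝟎 ∗ 𝟎) 𝟎 (subst (𝟎 ∗ 𝟎 ≤_) 𝟎≤𝟎∗𝟎 𝟎∗𝟎≤𝟎∗[𝟎∗𝟎]) 𝟎≤𝟎∗𝟎

  ∗-resp-𝟎 : ∀ {x y} → x ≡ 𝟎 → y ≡ 𝟎 → x ∗ y ≡ 𝟎
  ∗-resp-𝟎 x≡𝟎 y≡𝟎 = trans (cong₂ _∗_ x≡𝟎 y≡𝟎) 𝟎∗𝟎≡𝟎

  ≤𝟎⇒≡𝟎 : ∀ {x} → x ≤ 𝟎 → x ≡ 𝟎
  ≤𝟎⇒≡𝟎 {x} x≤𝟎 = A3 x 𝟎 x≤𝟎 (A3 (𝟎 ∗ x) 𝟎 𝟎∗x≤𝟎 𝟎≤𝟎∗x)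
    where
    𝟎∗[x∗𝟎]≡𝟎 : 𝟎 ∗ (x ∗ 𝟎) ≡ 𝟎
    𝟎∗[x∗𝟎]≡𝟎 = ∗-resp-𝟎 refl x≤𝟎

    𝟎∗x≤𝟎 : 𝟎 ∗ x ≤ 𝟎
    𝟎∗x≤𝟎 = subst₂ (λ s t → (s ∗ x) ∗ t ≡ 𝟎) 𝟎∗𝟎≡𝟎 (∗-resp-𝟎 𝟎∗[x∗𝟎]≡𝟎 refl) (G 𝟎 𝟎 x)

    𝟎≤𝟎∗x : 𝟎 ≤ 𝟎 ∗ x
    𝟎≤𝟎∗x =
      subst (λ s → 𝟎 ≤ s ∗ x)
            (∗-resp-𝟎 𝟎∗𝟎≡𝟎 (∗-resp-𝟎 (∗-resp-𝟎 𝟎∗[x∗𝟎]≡𝟎 refl) refl))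
            (G²ˡ 𝟎 𝟎 x)

  x≤y≡𝟎⇒x≡𝟎 : ∀ {x y} → x ≤ y → y ≡ 𝟎 → x ≡ 𝟎
  x≤y≡𝟎⇒x≡𝟎 {x} x≤y y≡𝟎 = ≤𝟎⇒≡𝟎 (subst (x ≤_) y≡𝟎 x≤y)

  x∗y≤[x∗𝟎]∗y : ∀ x y → x ∗ y ≤ (x ∗ 𝟎) ∗ y
  x∗y≤[x∗𝟎]∗y x y =
    ≤𝟎⇒≡𝟎 (≤𝟎⇒≡𝟎 (subst (λ s → ((x ∗ y) ∗ ((x ∗ s) ∗ y)) ∗ 𝟎 ≤ 𝟎)
                         (∗-resp-𝟎 𝟎∗𝟎≡𝟎 refl)
                         (G²ʳ x y 𝟎)))

  x∗𝟎≡x : ∀ x → x ∗ 𝟎 ≡ x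
  x∗𝟎≡x x = A3 (x ∗ 𝟎) x x∗𝟎≤x x≤x∗𝟎
    where
    x≤[x∗𝟎]∗𝟎 : x ≤ (x ∗ 𝟎) ∗ 𝟎
    x≤[x∗𝟎]∗𝟎 = x≤y≡𝟎⇒x≡𝟎 (x∗y≤[x∗𝟎]∗y x ((x ∗ 𝟎) ∗ 𝟎)) (x∗y≤[x∗𝟎]∗y x 𝟎)

    x∗𝟎≤x∗𝟎 : x ∗ 𝟎 ≤ x ∗ 𝟎
    x∗𝟎≤x∗𝟎 = x≤y≡𝟎⇒x≡𝟎 (G x 𝟎 (x ∗ 𝟎)) (∗-resp-𝟎 x≤[x∗𝟎]∗𝟎 refl)

    x≤x∗𝟎 : x ≤ x ∗ 𝟎
    x≤x∗𝟎 = x≤y≡𝟎⇒x≡𝟎 (x∗y≤[x∗𝟎]∗y x (x ∗ 𝟎)) x∗𝟎≤x∗𝟎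

    x∗𝟎≤x : x ∗ 𝟎 ≤ x
    x∗𝟎≤x = x≤y≡𝟎⇒x≡𝟎 (G x 𝟎 x) (∗-resp-𝟎 x≤x∗𝟎 refl)

lemma8 : ∀ {a : Level} (X : Set a) (_∗_ : X → X → X) (𝟎 : X)
         → (∀ x y z → ((x ∗ y) ∗ z) ∗ ((x ∗ (z ∗ 𝟎)) ∗ y) ≡ 𝟎)
         → (∀ x y → x ∗ y ≡ 𝟎 → y ∗ x ≡ 𝟎 → x ≡ y)
         → ∀ x y z → ((x ∗ y) ∗ z) ∗ ((x ∗ z) ∗ y) ≡ 𝟎
lemma8 _ _∗_ 𝟎 G A3 x y z =
  subst (λ s → ((x ∗ y) ∗ z) ∗ ((x ∗ s) ∗ y) ≡ 𝟎) (x∗𝟎≡x z) (G x y z)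
  where open Properties _∗_ 𝟎 G A3
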